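{- Let $t,u$ be CBN terms, $G$ a (CBN) full context and $R\in\{dB,s\}$. If $t \to_{G\langle R\rangle} u$ in CBN, then $t^{n} \to_{G^{n}\langle R^{n}\rangle} u^{n}$ in the Distant Bang Calculus.
   Context: Distant Bang Calculus. Terms: $t,u,s ::= x \mid t\,u \mid \lambda x.t \mid !t \mid \mathrm{der}(t) \mid t[x\backslash u]$; $\lambda x.t$ and $t[x\backslash u]$ bind $x$ in $t$; terms up to $\alpha$-conversion; $t\{x:=u\}$ is capture-avoiding substitution. Contexts have exactly one hole $\square$, $C\langle t\rangle$ is plugging. Full contexts: $F ::= \square \mid F\,t \mid t\,F \mid \lambda x.F \mid !F \mid \mathrm{der}(F) \mid F[x\backslash t] \mid t[x\backslash F]$; list contexts $L ::= \square \mid L[x\backslash t]$. Rules (capture-free w.r.t. $L$): $(dB)$ $L\langle \lambda x.t\rangle\,u \mapsto L\langle t[x\backslash u]\rangle$; $(s!)$ $t[x\backslash L\langle !u\rangle] \mapsto L\langle t\{x:=u\}\rangle$; $(d!)$ $\mathrm{der}(L\langle !t\rangle) \mapsto L\langle t\rangle$. For a context $C$ and rule $R$, $C\langle t\rangle \to_{C\langle R\rangle} C\langle u\rangle$ whenever $t\mapsto_R u$. CBN calculus. Terms $t,u ::= x \mid \lambda x.t \mid t\,u \mid t[x\backslash u]$ (same binding conventions); full contexts $G ::= \square \mid G\,t \mid t\,G \mid \lambda x.G \mid G[x\backslash t] \mid t[x\backslash G]$; list contexts $L ::= \square \mid L[x\backslash t]$. Rules: $(dB)$ $L\langle \lambda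 x.t\rangle\,u \mapsto L\langle t[x\backslash u]\rangle$ (capture-free), $(s)$ $t[x\backslash u]\mapsto t\{x:=u\}$; $t\to_{G\langle R\rangle}u$ means $t=G\langle t'\rangle$, $u=G\langle u'\rangle$, $t'\mapsto_R u'$. CBN embedding $(\cdot)^n$: $x^n=x$, $(\lambda x.t)^n=\lambda x.t^n$, $(t\,u)^n=t^n\,!u^n$, $(t[x\backslash u])^n=t^n[x\backslash !u^n]$; on contexts by the same clauses with $\square^n=\square$ (e.g. $(t\,G)^n = t^n\,!G^n$); on rule names $dB^n=dB$, $s^n=s!$. -}

module Defs where

-- Terms up to α-conversion are represented by well-scoped de Bruijn terms:
-- `Tm n` is the set of terms whose free variables are among n variables.
-- Binders (λ and explicit substitution [x\u]) bind variable index zero.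

open import Data.Nat using (ℕ; zero; suc)
open import Data.Fin using (Fin; zero; suc)

data Tm (n : ℕ) : Set where
  var  : Fin n → Tm n
  app  : Tm n → Tm n → Tm n
  lam  : Tm (suc n) → Tm n
  bang : Tm n → Tm n
  der  : Tm n → Tm n
  es   : Tm (suc n) → Tm n → Tm n          -- es t u = t[x\u]

Ren : ℕ → ℕ → Set
Ren n m = Fin n → Fin m

extR : ∀ {n m} → Ren n m → Ren (suc n) (suc m)
extR ρ zero    = zero
extR ρ (suc i) = suc (ρ i)

ren : ∀ {n m} → Ren n m → Tm n → Tm m
ren ρ (var i)   = var (ρ i)
ren ρ (app t u) = app (ren ρ t) (ren ρ u)
ren ρ (lam t)   = lam (ren (extR ρ) t)
ren ρ (bang t)  = bang (ren ρ t)
ren ρ (der t)   = der (ren ρ t)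
ren ρ (es t u)  = es (ren (extR ρ) t) (ren ρ u)

extS : ∀ {n m} → (Fin n → Tm m) → Fin (suc n) → Tm (suc m)
extS σ zero    = var zero
extS σ (suc i) = ren suc (σ i)

sub : ∀ {n m} → (Fin n → Tm m) → Tm n → Tm m
sub σ (var i)   = σ i
sub σ (app t u) = app (sub σ t) (sub σ u)
sub σ (lam t)   = lam (sub (extS σ) t)
sub σ (bang t)  = bang (sub σ t)
sub σ (der t)   = der (sub σ t)
sub σ (es t u)  = es (sub (extS σ) t) (sub σ u)

sub0 : ∀ {n} → Tm n → Fin (suc n) → Tm n
sub0 u zero    = u
sub0 u (suc i) = var i

_[0≔_] : ∀ {n} → Tm (suc n) → Tm n → Tm n
t [0≔ u ] = sub (sub0 u) t

-- List contexts L ::= □ | L[x\t] ; `LCtx n m`: outer scope n, hole scope m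
data LCtx (n : ℕ) : ℕ → Set where
  hole : LCtx n n
  esL  : ∀ {m} → LCtx (suc n) m → Tm n → LCtx n m

plugL : ∀ {n m} → LCtx n m → Tm m → Tm n
plugL hole       s = s
plugL (esL L t) s = es (plugL L s) t

-- weakening of the outer scope into the hole scope of L (this is what
-- "capture-free w.r.t. L" amounts to in de Bruijn notation)
wkL : ∀ {n m} → LCtx n m → Ren n m
wkL hole      i = i
wkL (esL L t) i = wkL L (suc i)

-- Full contexts; `Ctx n m`: outer scope n, hole scope m
data Ctx (n : ℕ) : ℕ → Set where
  hole  : Ctx n n
  appL  : ∀ {m} → Ctx n m → Tm n → Ctx n m
  appR  : ∀ {m} → Tm n → Ctx n m → Ctx n m
  lam   : ∀ {m} → Ctx (suc n) m → Ctx n m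
  bang  : ∀ {m} → Ctx n m → Ctx n m
  der   : ∀ {m} → Ctx n m → Ctx n m
  esL   : ∀ {m} → Ctx (suc n) m → Tm n → Ctx n m
  esR   : ∀ {m} → Tm (suc n) → Ctx n m → Ctx n m

plug : ∀ {n m} → Ctx n m → Tm m → Tm n
plug hole       s = s
plug (appL F t) s = app (plug F s) t
plug (appR t F) s = app t (plug F s)
plug (lam F)    s = lam (plug F s)
plug (bang F)   s = bang (plug F s)
plug (der F)    s = der (plug F s)
plug (esL F t)  s = es (plug F s) t
plug (esR t F)  s = es t (plug F s)

data Rule : Set where
  dB s! d! : Rule

data _↦[_]_ {n : ℕ} : Tm n → Rule → Tm n → Set where
  dB-rule : ∀ {m} (L : LCtx n m) (t : Tm (suc m)) (u : Tm n) →
            app (plugL L (lam t)) u ↦[ dB ] plugL L (es t (ren (wkL L) u))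
  s!-rule : ∀ {m} (L : LCtx n m) (t : Tm (suc n)) (u : Tm m) →
            es t (plugL L (bang u)) ↦[ s! ] plugL L (ren (extR (wkL L)) t [0≔ u ])
  d!-rule : ∀ {m} (L : LCtx n m) (t : Tm m) →
            der (plugL L (bang t)) ↦[ d! ] plugL L t

data _⟶⟨_∙_⟩_ {n : ℕ} : ∀ {m} → Tm n → Ctx n m → Rule → Tm n → Set where
  ctx : ∀ {m} (C : Ctx n m) (R : Rule) {t u : Tm m} →
        t ↦[ R ] u → plug C t ⟶⟨ C ∙ R ⟩ plug C u

data NTm (n : ℕ) : Set where
  var : Fin n → NTm n
  lam : NTm (suc n) → NTm n
  app : NTm n → NTm n → NTm n
  es  : NTm (suc n) → NTm n → NTm n

renN : ∀ {n m} → Ren n m → NTm n → NTm m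
renN ρ (var i)   = var (ρ i)
renN ρ (lam t)   = lam (renN (extR ρ) t)
renN ρ (app t u) = app (renN ρ t) (renN ρ u)
renN ρ (es t u)  = es (renN (extR ρ) t) (renN ρ u)

extSN : ∀ {n m} → (Fin n → NTm m) → Fin (suc n) → NTm (suc m)
extSN σ zero    = var zero
extSN σ (suc i) = renN suc (σ i)

subN : ∀ {n m} → (Fin n → NTm m) → NTm n → NTm m
subN σ (var i)   = σ i
subN σ (lam t)   = lam (subN (extSN σ) t)
subN σ (app t u) = app (subN σ t) (subN σ u)
subN σ (es t u)  = es (subN (extSN σ) t) (subN σ u)

sub0N : ∀ {n} → NTm n → Fin (suc n) → NTm n
sub0N u zero    = u
sub0N u (suc i) = var i

_[0≔_]N : ∀ {n} → NTm (suc n) → NTm n → NTm n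
t [0≔ u ]N = subN (sub0N u) t

data NLCtx (n : ℕ) : ℕ → Set where
  hole : NLCtx n n
  esL  : ∀ {m} → NLCtx (suc n) m → NTm n → NLCtx n m

plugNL : ∀ {n m} → NLCtx n m → NTm m → NTm n
plugNL hole      s = s
plugNL (esL L t) s = es (plugNL L s) t

wkNL : ∀ {n m} → NLCtx n m → Ren n m
wkNL hole      i = i
wkNL (esL L t) i = wkNL L (suc i)

data NCtx (n : ℕ) : ℕ → Set where
  hole  : NCtx n n
  appL  : ∀ {m} → NCtx n m → NTm n → NCtx n m
  appR  : ∀ {m} → NTm n → NCtx n m → NCtx n m
  lam   : ∀ {m} → NCtx (suc n) m → NCtx n m
  esL   : ∀ {m} → NCtx (suc n) m → NTm n → NCtx n m
  esR   : ∀ {m} → NTm (suc n) → NCtx n m → NCtx n m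

plugN : ∀ {n m} → NCtx n m → NTm m → NTm n
plugN hole       s = s
plugN (appL G t) s = app (plugN G s) t
plugN (appR t G) s = app t (plugN G s)
plugN (lam G)    s = lam (plugN G s)
plugN (esL G t)  s = es (plugN G s) t
plugN (esR t G)  s = es t (plugN G s)

data NRule : Set where
  dB s : NRule

data _↦N[_]_ {n : ℕ} : NTm n → NRule → NTm n → Set where
  dB-rule : ∀ {m} (L : NLCtx n m) (t : NTm (suc m)) (u : NTm n) →
            app (plugNL L (lam t)) u ↦N[ dB ] plugNL L (es t (renN (wkNL L) u))
  s-rule  : (t : NTm (suc n)) (u : NTm n) →
            es t u ↦N[ s ] (t [0≔ u ]N)

data _⟶N⟨_∙_⟩_ {n : ℕ} : ∀ {m} → NTm n → NCtx n m → NRule → NTm n → Set where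
  ctx : ∀ {m} (G : NCtx n m) (R : NRule) {t u : NTm m} →
        t ↦N[ R ] u → plugN G t ⟶N⟨ G ∙ R ⟩ plugN G u

_ⁿ : ∀ {n} → NTm n → Tm n
var x ⁿ   = var x
lam t ⁿ   = lam (t ⁿ)
app t u ⁿ = app (t ⁿ) (bang (u ⁿ))
es t u ⁿ  = es (t ⁿ) (bang (u ⁿ))

_ⁿᶜ : ∀ {n m} → NCtx n m → Ctx n m
hole ⁿᶜ     = hole
appL G t ⁿᶜ = appL (G ⁿᶜ) (bang (t ⁿ))
appR t G ⁿᶜ = appR (t ⁿ) (bang (G ⁿᶜ))
lam G ⁿᶜ    = lam (G ⁿᶜ)
esL G t ⁿᶜ  = esL (G ⁿᶜ) (bang (t ⁿ))
esR t G ⁿᶜ  = esR (t ⁿ) (bang (G ⁿᶜ))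

_ⁿʳ : NRule → Rule
dB ⁿʳ = dB
s ⁿʳ  = s!

-- The embedding commutes with renaming, substitution and plugging into
-- (list) contexts. Hence a root dB-step maps to the root dB-step in the
-- embedded list context, and a root s-step t[x\u] ↦ t{x:=u} maps to the
-- s!-step tⁿ[x\!uⁿ] ↦ tⁿ{x:=uⁿ} with the empty list context; the
-- surrounding context G is carried along as Gⁿ.
module Submission where

open import Defs
open import Data.Nat using (ℕ)
open import Data.Fin using (Fin; zero; suc)
open import Relation.Binary.PropositionalEquality

extR-cong : ∀ {n m} {ρ ρ′ : Ren n m} → ρ ≗ ρ′ → extR ρ ≗ extR ρ′
extR-cong e zero    = refl
extR-cong e (suc i) = cong suc (e i)

ren-cong : ∀ {n m} {ρ ρ′ : Ren n m} → ρ ≗ ρ′ → ∀ t → ren ρ t ≡ ren ρ′ t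
ren-cong e (var i)   = cong var (e i)
ren-cong e (app t u) = cong₂ app (ren-cong e t) (ren-cong e u)
ren-cong e (lam t)   = cong lam (ren-cong (extR-cong e) t)
ren-cong e (bang t)  = cong bang (ren-cong e t)
ren-cong e (der t)   = cong der (ren-cong e t)
ren-cong e (es t u)  = cong₂ es (ren-cong (extR-cong e) t) (ren-cong e u)

extR-identity : ∀ {n} {ρ : Ren n n} → (∀ i → ρ i ≡ i) → ∀ i → extR ρ i ≡ i
extR-identity e zero    = refl
extR-identity e (suc i) = cong suc (e i)

ren-identity : ∀ {n} {ρ : Ren n n} → (∀ i → ρ i ≡ i) → ∀ t → ren ρ t ≡ t
ren-identity e (var i)   = cong var (e i)
ren-identity e (app t u) = cong₂ app (ren-identity e t) (ren-identity e u)
ren-identity e (lam t)   = cong lam (ren-identity (extR-identity e) t)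
ren-identity e (bang t)  = cong bang (ren-identity e t)
ren-identity e (der t)   = cong der (ren-identity e t)
ren-identity e (es t u)  = cong₂ es (ren-identity (extR-identity e) t) (ren-identity e u)

extS-cong : ∀ {n m} {σ σ′ : Fin n → Tm m} → σ ≗ σ′ → extS σ ≗ extS σ′
extS-cong e zero    = refl
extS-cong e (suc i) = cong (ren suc) (e i)

sub-cong : ∀ {n m} {σ σ′ : Fin n → Tm m} → σ ≗ σ′ → ∀ t → sub σ t ≡ sub σ′ t
sub-cong e (var i)   = e i
sub-cong e (app t u) = cong₂ app (sub-cong e t) (sub-cong e u)
sub-cong e (lam t)   = cong lam (sub-cong (extS-cong e) t)
sub-cong e (bang t)  = cong bang (sub-cong e t)
sub-cong e (der t)   = cong der (sub-cong e t)
sub-cong e (es t u)  = cong₂ es (sub-cong (extS-cong e) t) (sub-cong e u)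

ⁿ-renN : ∀ {n m} (ρ : Ren n m) (t : NTm n) → renN ρ t ⁿ ≡ ren ρ (t ⁿ)
ⁿ-renN ρ (var i)   = refl
ⁿ-renN ρ (lam t)   = cong lam (ⁿ-renN (extR ρ) t)
ⁿ-renN ρ (app t u) = cong₂ (λ a b → app a (bang b)) (ⁿ-renN ρ t) (ⁿ-renN ρ u)
ⁿ-renN ρ (es t u)  = cong₂ (λ a b → es a (bang b)) (ⁿ-renN (extR ρ) t) (ⁿ-renN ρ u)

ⁿ-extSN : ∀ {n m} (σ : Fin n → NTm m) → (λ i → extSN σ i ⁿ) ≗ extS (λ i → σ i ⁿ)
ⁿ-extSN σ zero    = refl
ⁿ-extSN σ (suc i) = ⁿ-renN suc (σ i)

ⁿ-subN : ∀ {n m} (σ : Fin n → NTm m) (t : NTm n) → subN σ t ⁿ ≡ sub (λ i → σ i ⁿ) (t ⁿ)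
ⁿ-subN σ (var i)   = refl
ⁿ-subN σ (lam t)   = cong lam (trans (ⁿ-subN (extSN σ) t) (sub-cong (ⁿ-extSN σ) (t ⁿ)))
ⁿ-subN σ (app t u) = cong₂ (λ a b → app a (bang b)) (ⁿ-subN σ t) (ⁿ-subN σ u)
ⁿ-subN σ (es t u)  = cong₂ (λ a b → es a (bang b))
  (trans (ⁿ-subN (extSN σ) t) (sub-cong (ⁿ-extSN σ) (t ⁿ))) (ⁿ-subN σ u)

ⁿ-[0≔] : ∀ {n} (t : NTm (ℕ.suc n)) (u : NTm n) → (t [0≔ u ]N) ⁿ ≡ t ⁿ [0≔ u ⁿ ]
ⁿ-[0≔] t u = trans (ⁿ-subN (sub0N u) t) (sub-cong ⁿ-sub0N (t ⁿ))
  where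
  ⁿ-sub0N : (λ i → sub0N u i ⁿ) ≗ sub0 (u ⁿ)
  ⁿ-sub0N zero    = refl
  ⁿ-sub0N (suc i) = refl

_ⁿˡ : ∀ {n m} → NLCtx n m → LCtx n m
hole ⁿˡ    = hole
esL L t ⁿˡ = esL (L ⁿˡ) (bang (t ⁿ))

ⁿ-plugNL : ∀ {n m} (L : NLCtx n m) (w : NTm m) → plugNL L w ⁿ ≡ plugL (L ⁿˡ) (w ⁿ)
ⁿ-plugNL hole      w = refl
ⁿ-plugNL (esL L t) w = cong (λ a → es a (bang (t ⁿ))) (ⁿ-plugNL L w)

wkNL≗wkL : ∀ {n m} (L : NLCtx n m) → wkNL L ≗ wkL (L ⁿˡ)
wkNL≗wkL hole      i = refl
wkNL≗wkL (esL L t) i = wkNL≗wkL L (suc i)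

ⁿ-plugN : ∀ {n m} (G : NCtx n m) (w : NTm m) → plugN G w ⁿ ≡ plug (G ⁿᶜ) (w ⁿ)
ⁿ-plugN hole       w = refl
ⁿ-plugN (appL G t) w = cong (λ a → app a (bang (t ⁿ))) (ⁿ-plugN G w)
ⁿ-plugN (appR t G) w = cong (λ a → app (t ⁿ) (bang a)) (ⁿ-plugN G w)
ⁿ-plugN (lam G)    w = cong lam (ⁿ-plugN G w)
ⁿ-plugN (esL G t)  w = cong (λ a → es a (bang (t ⁿ))) (ⁿ-plugN G w)
ⁿ-plugN (esR t G)  w = cong (λ a → es (t ⁿ) (bang a)) (ⁿ-plugN G w)

ⁿ-↦ : ∀ {n} {t u : NTm n} {R : NRule} → t ↦N[ R ] u → (t ⁿ) ↦[ R ⁿʳ ] (u ⁿ)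
ⁿ-↦ (dB-rule L t u) =
  subst₂ (λ a b → app a (bang (u ⁿ)) ↦[ dB ] b)
    (sym (ⁿ-plugNL L (lam t))) (sym contractum)
    (dB-rule (L ⁿˡ) (t ⁿ) (bang (u ⁿ)))
  where
  open ≡-Reasoning
  contractum : plugNL L (es t (renN (wkNL L) u)) ⁿ
             ≡ plugL (L ⁿˡ) (es (t ⁿ) (bang (ren (wkL (L ⁿˡ)) (u ⁿ))))
  contractum = begin
    plugNL L (es t (renN (wkNL L) u)) ⁿ
      ≡⟨ ⁿ-plugNL L (es t (renN (wkNL L) u)) ⟩
    plugL (L ⁿˡ) (es (t ⁿ) (bang (renN (wkNL L) u ⁿ)))
      ≡⟨ cong (λ a → plugL (L ⁿˡ) (es (t ⁿ) (bang a))) (ⁿ-renN (wkNL L) u) ⟩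
    plugL (L ⁿˡ) (es (t ⁿ) (bang (ren (wkNL L) (u ⁿ))))
      ≡⟨ cong (λ a → plugL (L ⁿˡ) (es (t ⁿ) (bang a))) (ren-cong (wkNL≗wkL L) (u ⁿ)) ⟩
    plugL (L ⁿˡ) (es (t ⁿ) (bang (ren (wkL (L ⁿˡ)) (u ⁿ)))) ∎
ⁿ-↦ (s-rule t u) =
  subst (λ b → es (t ⁿ) (bang (u ⁿ)) ↦[ s! ] b) contractum (s!-rule hole (t ⁿ) (u ⁿ))
  where
  open ≡-Reasoning
  contractum : ren (extR (λ i → i)) (t ⁿ) [0≔ u ⁿ ] ≡ (t [0≔ u ]N) ⁿ
  contractum = begin
    ren (extR (λ i → i)) (t ⁿ) [0≔ u ⁿ ]
      ≡⟨ cong (_[0≔ u ⁿ ]) (ren-identity (extR-identity (λ _ → refl)) (t ⁿ)) ⟩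
    t ⁿ [0≔ u ⁿ ]
      ≡⟨ sym (ⁿ-[0≔] t u) ⟩
    (t [0≔ u ]N) ⁿ ∎

lemma2 : ∀ {n m} (t u : NTm n) (G : NCtx n m) (R : NRule) →
    t ⟶N⟨ G ∙ R ⟩ u → (t ⁿ) ⟶⟨ (G ⁿᶜ) ∙ (R ⁿʳ) ⟩ (u ⁿ)
lemma2 _ _ G R (ctx .G .R {t} {u} t↦u) =
  subst₂ (λ a b → a ⟶⟨ G ⁿᶜ ∙ R ⁿʳ ⟩ b) (sym (ⁿ-plugN G t)) (sym (ⁿ-plugN G u))
    (ctx (G ⁿᶜ) (R ⁿʳ) (ⁿ-↦ t↦u))
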